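{- Let $n$ be a positive integer, let $i$ be a positive integer with $i\le\left\lfloor\frac{n-1}{2}\right\rfloor$, and let $\pi\in S_n$. Put $\rho=s_{123,132}^{\,i+\lfloor (n-1)/2\rfloor}(\pi)$. Then $\rho_{n-1}\rho_{n-3}\cdots\rho_{n-2i+1}$ is the identity permutation of length $i$, i.e. $\rho_{n-2m+1}=m$ for every $m=1,\dots,i$.
   Context: $S_n$ is the set of permutations of $\{1,\dots,n\}$ in one-line notation. A sequence of distinct integers contains a pattern $\tau\in S_m$ if it has a subsequence in the same relative order as $\tau$; otherwise it avoids $\tau$. The map $s_{123,132}:S_n\to S_n$: read the entries of $\pi$ left to right using one stack (initially empty); at each step, if there is a remaining input entry $x$ and placing $x$ on top of the stack gives a stack whose contents read from top to bottom avoid both $123$ and $132$, push $x$ (pushing has priority); otherwise pop the top of the stack to the output. When the input is exhausted, pop the remaining stack entries from the top to the output. The output is $s_{123,132}(\pi)$; $s^k_{123,132}$ denotes its $k$-fold iterate. -}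

module Defs where

open import Data.Nat using (ℕ; zero; suc; _+_; _*_; _<ᵇ_)
open import Data.Bool using (Bool; true; false; if_then_else_; _∧_; not)
open import Data.List using (List; []; _∷_; length; map; upTo; _++_)
open import Data.Bool.ListAction using (any)
open import Data.Maybe using (Maybe; just; nothing)

subseqs : ℕ → List ℕ → List (List ℕ)
subseqs zero    _        = [] ∷ []
subseqs (suc k) []       = []
subseqs (suc k) (x ∷ xs) = map (x ∷_) (subseqs k xs) ++ subseqs (suc k) xs

sameOrder : List ℕ → List ℕ → Bool
sameOrder []       []       = true
sameOrder (x ∷ xs) (y ∷ ys) = pairs xs ys ∧ sameOrder xs ys
  where
  pairs : List ℕ → List ℕ → Bool
  pairs []       []       = true
  pairs (a ∷ as) (b ∷ bs) = ((x <ᵇ a) ⇔ᵇ (y <ᵇ b)) ∧ ((a <ᵇ x) ⇔ᵇ (b <ᵇ y)) ∧ pairs as bs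
    where
    _⇔ᵇ_ : Bool → Bool → Bool
    true  ⇔ᵇ b = b
    false ⇔ᵇ b = not b
  pairs _        _        = false
sameOrder _        _        = false

contains : List ℕ → List ℕ → Bool
contains σ τ = any (λ s → sameOrder s τ) (subseqs (length τ) σ)

avoids123-132 : List ℕ → Bool
avoids123-132 σ = not (contains σ (1 ∷ 2 ∷ 3 ∷ [])) ∧ not (contains σ (1 ∷ 3 ∷ 2 ∷ []))

-- One pass of the stack; the stack is a list read top to bottom (head = top).
-- Fuel bounds the number of steps (2n+1 suffices: each entry is pushed and popped once).
stackRun : ℕ → List ℕ → List ℕ → List ℕ
stackRun zero    _        st = st
stackRun (suc f) []       st = st
stackRun (suc f) (x ∷ xs) st =
  if avoids123-132 (x ∷ st) then stackRun f xs (x ∷ st) else popOr st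
  where
  popOr : List ℕ → List ℕ
  popOr []       = stackRun f xs (x ∷ [])   -- unreachable: a one-entry stack avoids both patterns
  popOr (y ∷ ys) = y ∷ stackRun f (x ∷ xs) ys

s123-132 : List ℕ → List ℕ
s123-132 π = stackRun (suc (2 * length π)) π []

iter : ℕ → (List ℕ → List ℕ) → List ℕ → List ℕ
iter zero    f x = x
iter (suc k) f x = iter k f (f x)

-- The list 1,2,...,n (S_n = lists that are permutations of it).
oneTo : ℕ → List ℕ
oneTo n = map suc (upTo n)

-- 1-indexed entry of a list.
entry : List ℕ → ℕ → Maybe ℕ
entry []       _             = nothing
entry (x ∷ xs) zero          = nothing
entry (x ∷ xs) (suc zero)    = just x
entry (x ∷ xs) (suc (suc p)) = entry xs (suc p)

-- Write after v σ for the entries following v in σ, and σₜ for the t-th iterate of π.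
-- For 1 ≤ v with 2v < n: (A) |after v σₜ| < 2v once t ≥ v; (B) at most v − 1 − k entries
-- smaller than v precede v once t ≥ v + k; (C) |after v σₜ| = 2v − 1 once t ≥ 2v.
-- The theorem is (C) for v = m at t = i + ⌊(n−1)/2⌋ ≥ 2m.
-- Each step is one pass over σₜ, whose first entry b exceeds v ((A) for b rules out b ≤ v):
-- afterwards v is followed by 1 + s + |R| entries, where R begins with the first entry after
-- v that is smaller than v, and s counts the entries smaller than v that preceded v and are
-- still under it on the stack; s > 0 exactly when such entries existed.  (A) follows by
-- strong induction on v, comparing with the head of R or with the first smaller entry
-- before v; (B) by induction on k; (C) by induction on v, as (A) and (B) make v − 1 the head of R.
module Submission where

open import Defs
open import Data.Bool.Base using (true; false; T; not; _∧_; if_then_else_)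
open import Data.Bool.Properties using (T-≡; ∧-zeroʳ)
open import Data.Nat.Base using (ℕ; zero; suc; _+_; _*_; _∸_; _/_; _≤_; _<_; _<ᵇ_; _≡ᵇ_; z≤n; s≤s)
open import Data.Nat.Properties
open import Data.Nat.DivMod using (m/n*n≤m)
open import Data.Nat.Induction using (<-rec)
open import Data.Nat.Solver using (module +-*-Solver)
open import Data.List.Base using (List; []; _∷_; _++_; length; map; filter; head; upTo)
open import Data.List.Properties
  using (++-assoc; ++-identityʳ; length-++; length-map; length-upTo; upTo-∷ʳ; map-++;
         filter-++; length-filter; filter-some; filter-accept; filter-reject; filter-none)
open import Data.List.Membership.Propositional using (_∈_; _∉_; find; lose)
open import Data.List.Membership.Propositional.Properties
  using (∈-filter⁻; ∈-++⁺ˡ; ∈-++⁺ʳ; ∈-++⁻; ∈-map⁺; ∈-map⁻; ∈-upTo⁺)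
open import Data.List.Relation.Unary.Any using (here; there)
import Data.List.Relation.Unary.Any.Properties as Any
open import Data.List.Relation.Unary.All as All using (All; []; _∷_)
import Data.List.Relation.Unary.All.Properties as All
open import Data.List.Relation.Unary.Unique.Propositional using (Unique; []; _∷_)
import Data.List.Relation.Unary.Unique.Propositional.Properties as Unique
open import Data.List.Relation.Binary.Permutation.Propositional
  using (_↭_; ↭-refl; ↭-sym; ↭-trans; ↭-reflexive; prep; ↭⇒↭ₛ; module PermutationReasoning)
open import Data.List.Relation.Binary.Permutation.Propositional.Properties
  using (filter-↭; ↭-length; ∈-resp-↭; ++⁺ˡ; shift; shifts)
import Data.List.Relation.Binary.Permutation.Setoid.Properties as Permutationₛ
open import Data.Maybe.Base using (just)
open import Data.Maybe.Relation.Unary.All as Maybe using (just; nothing)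
open import Data.Product.Base using (∃-syntax; _×_; _,_; proj₁; proj₂; map₁)
open import Data.Sum.Base using (_⊎_; inj₁; inj₂)
open import Function.Base using (_∘_)
open import Function.Bundles using (Equivalence)
open import Relation.Nullary using (¬_; yes; no; contradiction)
open import Relation.Binary.Definitions using (tri<; tri≈; tri>)
open import Relation.Binary.PropositionalEquality
  using (_≡_; _≢_; refl; sym; trans; cong; cong₂; subst; setoid; module ≡-Reasoning)

open +-*-Solver using (solve; _:+_; _:=_; con)

-- Counting entries below and above a threshold

below above : ℕ → List ℕ → ℕ
below v xs = length (filter (_<? v) xs)
above v xs = length (filter (v <?_) xs)

below-++ : ∀ v xs ys → below v (xs ++ ys) ≡ below v xs + below v ys
below-++ v xs ys = trans (cong length (filter-++ (_<? v) xs ys)) (length-++ (filter (_<? v) xs))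

above-++ : ∀ v xs ys → above v (xs ++ ys) ≡ above v xs + above v ys
above-++ v xs ys = trans (cong length (filter-++ (v <?_) xs ys)) (length-++ (filter (v <?_) xs))

above-++ʳ : ∀ v xs ys → above v ys ≤ above v (xs ++ ys)
above-++ʳ v xs ys = ≤-trans (m≤n+m (above v ys) (above v xs)) (≤-reflexive (sym (above-++ v xs ys)))

below-↭ : ∀ v {xs ys} → xs ↭ ys → below v xs ≡ below v ys
below-↭ v p = ↭-length (filter-↭ (_<? v) p)

below-accept : ∀ {v y} ys → y < v → below v (y ∷ ys) ≡ suc (below v ys)
below-accept ys y<v = cong length (filter-accept (_<? _) {xs = ys} y<v)

below-reject : ∀ {v y} ys → ¬ y < v → below v (y ∷ ys) ≡ below v ys
below-reject ys y≮v = cong length (filter-reject (_<? _) {xs = ys} y≮v)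

above-accept : ∀ {v y} ys → v < y → above v (y ∷ ys) ≡ suc (above v ys)
above-accept ys v<y = cong length (filter-accept (_ <?_) {xs = ys} v<y)

above-reject : ∀ {v y} ys → ¬ v < y → above v (y ∷ ys) ≡ above v ys
above-reject ys v≮y = cong length (filter-reject (_ <?_) {xs = ys} v≮y)

below-∈ : ∀ {v x xs} → x ∈ xs → x < v → 0 < below v xs
below-∈ x∈ x<v = filter-some (_<? _) (lose x∈ x<v)

above-∈ : ∀ {v x xs} → x ∈ xs → v < x → 0 < above v xs
above-∈ x∈ v<x = filter-some (_ <?_) (lose x∈ v<x)

above-∈⁻ : ∀ {v} xs → 0 < above v xs → ∃[ c ] c ∈ xs × v < c
above-∈⁻ {v} xs pos with filter (v <?_) xs in eq
... | c ∷ _ = c , ∈-filter⁻ (v <?_) (subst (c ∈_) (sym eq) (here refl))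

below-none : ∀ {v xs} → All (λ x → ¬ x < v) xs → below v xs ≡ 0
below-none {v} none = cong length (filter-none (_<? v) none)

below≡0⇒none : ∀ {v} xs → below v xs ≡ 0 → All (λ x → ¬ x < v) xs
below≡0⇒none xs none = All.tabulate λ x∈ x<v → contradiction (subst (0 <_) none (below-∈ x∈ x<v)) λ ()

above-antitone : ∀ {x y} → x ≤ y → ∀ zs → above y zs ≤ above x zs
above-antitone x≤y [] = z≤n
above-antitone {x} {y} x≤y (z ∷ zs) with y <? z | x <? z
... | yes y<z | yes x<z = begin
  above y (z ∷ zs)  ≡⟨ above-accept zs y<z ⟩
  suc (above y zs)  ≤⟨ s≤s (above-antitone x≤y zs) ⟩
  suc (above x zs)  ≡⟨ above-accept zs x<z ⟨
  above x (z ∷ zs)  ∎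
  where open ≤-Reasoning
... | yes y<z | no x≮z  = contradiction (≤-<-trans x≤y y<z) x≮z
... | no y≮z  | _       = begin
  above y (z ∷ zs)  ≡⟨ above-reject zs y≮z ⟩
  above y zs        ≤⟨ above-antitone x≤y zs ⟩
  above x zs        ≤⟨ above-++ʳ x (z ∷ []) zs ⟩
  above x (z ∷ zs)  ∎
  where open ≤-Reasoning

length≡below+above : ∀ {v} xs → v ∉ xs → length xs ≡ below v xs + above v xs
length≡below+above []       _  = refl
length≡below+above {v} (x ∷ xs) v∉ with <-cmp x v
... | tri< x<v _ x≯v = begin
  suc (length xs)                      ≡⟨ cong suc (length≡below+above xs (v∉ ∘ there)) ⟩
  suc (below v xs + above v xs)        ≡⟨ cong₂ _+_ (below-accept xs x<v) (above-reject xs x≯v) ⟨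
  below v (x ∷ xs) + above v (x ∷ xs)  ∎
  where open ≡-Reasoning
... | tri≈ _ x≡v _ = contradiction (here (sym x≡v)) v∉
... | tri> x≮v _ v<x = begin
  suc (length xs)                      ≡⟨ cong suc (length≡below+above xs (v∉ ∘ there)) ⟩
  suc (below v xs + above v xs)        ≡⟨ +-suc (below v xs) (above v xs) ⟨
  below v xs + suc (above v xs)        ≡⟨ cong₂ _+_ (below-reject xs x≮v) (above-accept xs v<x) ⟨
  below v (x ∷ xs) + above v (x ∷ xs)  ∎
  where open ≡-Reasoning

first-below : ∀ {v} xs → 0 < below v xs →
  ∃[ ys ] ∃[ w ] ∃[ zs ] xs ≡ ys ++ w ∷ zs × w < v × All (λ y → ¬ y < v) ys
first-below {v} (x ∷ xs) pos with x <? v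
... | yes x<v = [] , x , xs , refl , x<v , []
... | no x≮v with first-below xs (subst (0 <_) (below-reject xs x≮v) pos)
...   | ys , w , zs , refl , w<v , none = x ∷ ys , w , zs , refl , w<v , x≮v ∷ none

last-below : ∀ {v} xs → 0 < below v xs →
  ∃[ ys ] ∃[ w ] ∃[ zs ] xs ≡ ys ++ w ∷ zs × w < v × All (λ z → ¬ z < v) zs
last-below {v} (x ∷ xs) pos with 0 <? below v xs
... | yes pos′ with last-below xs pos′
...   | ys , w , zs , refl , w<v , none = x ∷ ys , w , zs , refl , w<v , none
last-below {v} (x ∷ xs) pos | no ¬pos′ with x <? v
...   | yes x<v = [] , x , xs , refl , x<v , below≡0⇒none xs (n≤0⇒n≡0 (≮⇒≥ ¬pos′))
...   | no x≮v  = contradiction (subst (0 <_) (below-reject xs x≮v) pos) ¬pos′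

-- Pushing onto a stack that avoids 123 and 132

<ᵇ-true : ∀ {m n} → m < n → (m <ᵇ n) ≡ true
<ᵇ-true = Equivalence.to T-≡ ∘ <⇒<ᵇ

<ᵇ-false : ∀ {m n} → n ≤ m → (m <ᵇ n) ≡ false
<ᵇ-false {m} {n} n≤m with m <ᵇ n in e
... | false = refl
... | true  = contradiction (<ᵇ⇒< m n (subst T (sym e) _)) (≤⇒≯ n≤m)

subseqs-above : ∀ {x} k σ {s} → s ∈ subseqs k σ → All (x <_) s → k ≤ above x σ
subseqs-above zero    σ        _  _ = z≤n
subseqs-above (suc k) (y ∷ ys) s∈ xs< with ∈-++⁻ (map (y ∷_) (subseqs k ys)) s∈
... | inj₂ s∈′ = ≤-trans (subseqs-above (suc k) ys s∈′ xs<) (above-++ʳ _ (y ∷ []) ys)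
... | inj₁ s∈′ with ∈-map⁻ (y ∷_) s∈′
...   | s′ , s′∈ , refl with xs<
...     | x<y ∷ xs′< = ≤-trans (s≤s (subseqs-above k ys s′∈ xs′<)) (≤-reflexive (sym (above-accept ys x<y)))

∈-subseqs-1 : ∀ {c ys} → c ∈ ys → (c ∷ []) ∈ subseqs 1 ys
∈-subseqs-1 {ys = _ ∷ _} (here refl) = here refl
∈-subseqs-1 {ys = _ ∷ _} (there c∈)  = there (∈-subseqs-1 c∈)

above-pair : ∀ {x} σ → Unique σ → 2 ≤ above x σ →
  ∃[ a ] ∃[ c ] (a ∷ c ∷ []) ∈ subseqs 2 σ × x < a × x < c × a ≢ c
above-pair {x} (y ∷ ys) (y∉ys ∷ u) two with x <? y
... | yes x<y with above-∈⁻ ys (≤-pred (subst (2 ≤_) (above-accept ys x<y) two))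
...   | c , c∈ , x<c =
  y , c , ∈-++⁺ˡ (∈-map⁺ (y ∷_) (∈-subseqs-1 c∈)) , x<y , x<c , λ { refl → All.lookup y∉ys c∈ refl }
above-pair {x} (y ∷ ys) (_ ∷ u) two | no x≮y with above-pair ys u (subst (2 ≤_) (above-reject ys x≮y) two)
...   | a , c , ac∈ , rest = a , c , ∈-++⁺ʳ (map (y ∷_) (subseqs 1 ys)) ac∈ , rest

contains-∷⁻ : ∀ {x σ p τ} → contains (x ∷ σ) (p ∷ τ) ≡ true →
  contains σ (p ∷ τ) ≡ true ⊎ ∃[ s ] s ∈ subseqs (length τ) σ × sameOrder (x ∷ s) (p ∷ τ) ≡ true
contains-∷⁻ {x} {σ} {p} {τ} h
  with Any.++⁻ (map (x ∷_) (subseqs (length τ) σ)) (Any.any⁻ _ _ (Equivalence.from T-≡ h))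
... | inj₂ old = inj₁ (Equivalence.to T-≡ (Any.any⁺ _ old))
... | inj₁ new with find (Any.map⁻ new)
...   | s , s∈ , so = inj₂ (s , s∈ , Equivalence.to T-≡ so)

contains-∷⁺ : ∀ {x σ p τ s} → s ∈ subseqs (length τ) σ → sameOrder (x ∷ s) (p ∷ τ) ≡ true →
  contains (x ∷ σ) (p ∷ τ) ≡ true
contains-∷⁺ s∈ so =
  Equivalence.to T-≡ (Any.any⁺ _ (Any.++⁺ˡ (Any.map⁺ (lose s∈ (Equivalence.from T-≡ so)))))

sameOrder-least⁻ : ∀ {x} q r s → sameOrder (x ∷ s) (1 ∷ suc (suc q) ∷ suc (suc r) ∷ []) ≡ true → All (x <_) s
sameOrder-least⁻ q r [] ()
sameOrder-least⁻ {x} q r (a ∷ []) h with x <ᵇ a | a <ᵇ x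
sameOrder-least⁻ q r (a ∷ []) () | true  | true
sameOrder-least⁻ q r (a ∷ []) () | true  | false
sameOrder-least⁻ q r (a ∷ []) () | false | _
sameOrder-least⁻ {x} q r (a ∷ c ∷ []) h with x <ᵇ a in xa | a <ᵇ x | x <ᵇ c in xc | c <ᵇ x
... | true | false | true | false = <ᵇ⇒< x a (Equivalence.from T-≡ xa) ∷ <ᵇ⇒< x c (Equivalence.from T-≡ xc) ∷ []
sameOrder-least⁻ {x} q r (a ∷ c ∷ d ∷ s) h with x <ᵇ a | a <ᵇ x | x <ᵇ c | c <ᵇ x
sameOrder-least⁻ q r (a ∷ c ∷ d ∷ s) () | true | false | true | false

sameOrder-123 : ∀ {x a c} → x < a → x < c → a < c → sameOrder (x ∷ a ∷ c ∷ []) (1 ∷ 2 ∷ 3 ∷ []) ≡ true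
sameOrder-123 x<a x<c a<c
  rewrite <ᵇ-true x<a | <ᵇ-false (<⇒≤ x<a) | <ᵇ-true x<c | <ᵇ-false (<⇒≤ x<c)
        | <ᵇ-true a<c | <ᵇ-false (<⇒≤ a<c) = refl

sameOrder-132 : ∀ {x a c} → x < a → x < c → c < a → sameOrder (x ∷ a ∷ c ∷ []) (1 ∷ 3 ∷ 2 ∷ []) ≡ true
sameOrder-132 x<a x<c c<a
  rewrite <ᵇ-true x<a | <ᵇ-false (<⇒≤ x<a) | <ᵇ-true x<c | <ᵇ-false (<⇒≤ x<c)
        | <ᵇ-true c<a | <ᵇ-false (<⇒≤ c<a) = refl

-- An occurrence of 123 or 132 in x ∷ σ that uses x is exactly a pair of entries of σ above x.
push-avoids-least : ∀ q r {x σ} → let τ = 1 ∷ suc (suc q) ∷ suc (suc r) ∷ [] in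
  contains σ τ ≡ false → above x σ ≤ 1 → contains (x ∷ σ) τ ≡ false
push-avoids-least q r {x} {σ} old few with contains (x ∷ σ) (1 ∷ suc (suc q) ∷ suc (suc r) ∷ []) in e
... | false = refl
... | true with contains-∷⁻ {x} {σ} e
...   | inj₁ old′ = contradiction (trans (sym old′) old) λ ()
...   | inj₂ (s , s∈ , so) = contradiction (subseqs-above 2 σ s∈ (sameOrder-least⁻ q r s so)) (<⇒≱ (s≤s few))

push-avoids : ∀ {x σ} → avoids123-132 σ ≡ true → above x σ ≤ 1 → avoids123-132 (x ∷ σ) ≡ true
push-avoids {x} {σ} av few with contains σ (1 ∷ 2 ∷ 3 ∷ []) in e₁ | contains σ (1 ∷ 3 ∷ 2 ∷ []) in e₂
... | false | false =
  cong₂ (λ c₁ c₂ → not c₁ ∧ not c₂) (push-avoids-least 0 1 {x} {σ} e₁ few) (push-avoids-least 1 0 {x} {σ} e₂ few)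

push-blocked : ∀ {x σ} → Unique σ → 2 ≤ above x σ → avoids123-132 (x ∷ σ) ≡ false
push-blocked {x} {σ} u many with above-pair σ u many
... | a , c , ac∈ , x<a , x<c , a≢c with <-cmp a c
...   | tri< a<c _ _ = cong (λ c₁ → not c₁ ∧ not (contains (x ∷ σ) (1 ∷ 3 ∷ 2 ∷ [])))
                         (contains-∷⁺ {x} {σ} {1} {2 ∷ 3 ∷ []} ac∈ (sameOrder-123 x<a x<c a<c))
...   | tri≈ _ a≡c _ = contradiction a≡c a≢c
...   | tri> _ _ c<a = trans (cong (λ c₂ → not (contains (x ∷ σ) (1 ∷ 2 ∷ 3 ∷ [])) ∧ not c₂)
                                (contains-∷⁺ {x} {σ} {1} {3 ∷ 2 ∷ []} ac∈ (sameOrder-132 x<a x<c c<a)))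
                         (∧-zeroʳ _)

avoids⇒above≤1 : ∀ {x σ} → Unique σ → avoids123-132 (x ∷ σ) ≡ true → above x σ ≤ 1
avoids⇒above≤1 {x} {σ} u av with 2 ≤? above x σ
... | yes many = contradiction (trans (sym av) (push-blocked u many)) λ ()
... | no few   = ≤-pred (≰⇒> few)

-- Splitting a list at an entry

Unique-resp-↭ : ∀ {xs ys : List ℕ} → xs ↭ ys → Unique xs → Unique ys
Unique-resp-↭ p = Permutationₛ.Unique-resp-↭ (setoid ℕ) (↭⇒↭ₛ p)

Unique-++⁻ˡ : ∀ (xs : List ℕ) {ys} → Unique (xs ++ ys) → Unique xs
Unique-++⁻ˡ []       _        = []
Unique-++⁻ˡ (x ∷ xs) (x∉ ∷ u) = All.++⁻ˡ xs x∉ ∷ Unique-++⁻ˡ xs u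

Unique-++⁻ʳ : ∀ (xs : List ℕ) {ys} → Unique (xs ++ ys) → Unique ys
Unique-++⁻ʳ []       u       = u
Unique-++⁻ʳ (x ∷ xs) (_ ∷ u) = Unique-++⁻ʳ xs u

before after : ℕ → List ℕ → List ℕ
before v []       = []
before v (x ∷ xs) = if x ≡ᵇ v then [] else x ∷ before v xs
after  v []       = []
after  v (x ∷ xs) = if x ≡ᵇ v then xs else after v xs

≡ᵇ-refl : ∀ v → (v ≡ᵇ v) ≡ true
≡ᵇ-refl v = Equivalence.to T-≡ (≡⇒≡ᵇ v v refl)

split-at : ∀ {v} pre post → v ∉ pre → before v (pre ++ v ∷ post) ≡ pre × after v (pre ++ v ∷ post) ≡ post
split-at {v} []        post _ rewrite ≡ᵇ-refl v = refl , refl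
split-at {v} (x ∷ pre) post v∉ with x ≡ᵇ v in e
... | true  = contradiction (here (sym (≡ᵇ⇒≡ x v (Equivalence.from T-≡ e)))) v∉
... | false = cong (x ∷_) (proj₁ (split-at pre post (v∉ ∘ there))) , proj₂ (split-at pre post (v∉ ∘ there))

split-unique : ∀ {v} pre post → Unique (pre ++ v ∷ post) →
  before v (pre ++ v ∷ post) ≡ pre × after v (pre ++ v ∷ post) ≡ post
split-unique pre post u = split-at pre post v∉pre
  where
  v∉pre : _ ∉ pre
  v∉pre v∈ with Unique-resp-↭ (shift _ pre post) u
  ... | v∉ ∷ _ = All.lookup v∉ (∈-++⁺ˡ v∈) refl

∈⇒split : ∀ {v} xs → v ∈ xs → xs ≡ before v xs ++ v ∷ after v xs
∈⇒split {v} (x ∷ xs) v∈ with x ≡ᵇ v in e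
... | true = cong (_∷ xs) (≡ᵇ⇒≡ x v (Equivalence.from T-≡ e))
... | false with v∈
...   | here refl = contradiction (trans (sym e) (≡ᵇ-refl v)) λ ()
...   | there v∈′ = cong (x ∷_) (∈⇒split xs v∈′)

span-above : ∀ v xs → v ∉ xs → ∃[ M ] ∃[ R ] xs ≡ M ++ R × All (v <_) M × Maybe.All (_< v) (head R)
span-above v []       _  = [] , [] , refl , [] , nothing
span-above v (x ∷ xs) v∉ with v <? x
... | yes v<x = let M , R , eq , larger , smaller = span-above v xs (v∉ ∘ there)
                in x ∷ M , R , cong (x ∷_) eq , v<x ∷ larger , smaller
... | no v≮x  = [] , x ∷ xs , refl , [] , just (≤∧≢⇒< (≮⇒≥ v≮x) (λ x≡v → v∉ (here (sym x≡v))))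

decompose : ∀ {v} X → Unique X → v ∈ X →
  ∃[ L ] ∃[ M ] ∃[ R ] X ≡ L ++ v ∷ M ++ R × All (v <_) M × Maybe.All (_< v) (head R)
decompose {v} X u v∈ with span-above v (after v X) v∉after
  where
  v∉after : v ∉ after v X
  v∉after with Unique-++⁻ʳ (before v X) (subst Unique (∈⇒split X v∈) u)
  ... | v∉ ∷ _ = λ v∈′ → All.lookup v∉ v∈′ refl
... | M , R , eq , larger , smaller =
  before v X , M , R , trans (∈⇒split X v∈) (cong (λ A → before v X ++ v ∷ A) eq) , larger , smaller

after-shrinks : ∀ {x y} xs → Unique xs → x ∈ xs → y ∈ after x xs → length (after y xs) < length (after x xs)
after-shrinks {x} {y} xs u x∈ y∈ = begin-strict
  length (after y xs)                             ≡⟨ cong length after-y ⟩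
  length (after y A)                              <⟨ m≤n+m (suc (length (after y A))) (length (before y A)) ⟩
  length (before y A) + suc (length (after y A))  ≡⟨ length-++ (before y A) ⟨
  length (before y A ++ y ∷ after y A)            ≡⟨ cong length (∈⇒split A y∈) ⟨
  length A                                        ∎
  where
  open ≤-Reasoning
  A = after x xs
  xs≡ : xs ≡ (before x xs ++ x ∷ before y A) ++ y ∷ after y A
  xs≡ = trans (∈⇒split xs x∈) (trans (cong (λ A′ → before x xs ++ x ∷ A′) (∈⇒split A y∈))
                                      (sym (++-assoc (before x xs) (x ∷ before y A) (y ∷ after y A))))
  after-y : after y xs ≡ after y A
  after-y = trans (cong (after y) xs≡) (proj₂ (split-unique (before x xs ++ x ∷ before y A) (after y A) (subst Unique xs≡ u)))

below-before : ∀ {v} xs → v ∈ xs → below v (before v xs) ≤ below v xs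
below-before {v} xs v∈ = begin
  below v (before v xs)                             ≤⟨ m≤m+n _ _ ⟩
  below v (before v xs) + below v (v ∷ after v xs)  ≡⟨ below-++ v (before v xs) (v ∷ after v xs) ⟨
  below v (before v xs ++ v ∷ after v xs)           ≡⟨ cong (below v) (∈⇒split xs v∈) ⟨
  below v xs                                        ∎
  where open ≤-Reasoning

∈-after : ∀ {v x} xs → v ∈ xs → below v (before v xs) ≡ 0 → x ∈ xs → x < v → x ∈ after v xs
∈-after {v} {x} xs v∈ none x∈ x<v with ∈-++⁻ (before v xs) (subst (x ∈_) (∈⇒split xs v∈) x∈)
... | inj₁ x∈before    = contradiction x<v (All.lookup (below≡0⇒none (before v xs) none) x∈before)
... | inj₂ (here refl) = contradiction x<v (<-irrefl refl)
... | inj₂ (there x∈′) = x∈′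

entry-at : ∀ pre (x : ℕ) post → entry (pre ++ x ∷ post) (suc (length pre)) ≡ just x
entry-at []            x post = refl
entry-at (y ∷ [])      x post = refl
entry-at (y ∷ z ∷ pre) x post = entry-at (z ∷ pre) x post

entry-from-end : ∀ pre (x : ℕ) post →
  entry (pre ++ x ∷ post) (length (pre ++ x ∷ post) ∸ suc (length post) + 1) ≡ just x
entry-from-end pre x post = subst (λ k → entry (pre ++ x ∷ post) k ≡ just x) (sym position) (entry-at pre x post)
  where
  position : length (pre ++ x ∷ post) ∸ suc (length post) + 1 ≡ suc (length pre)
  position = trans (cong (λ k → k ∸ suc (length post) + 1) (length-++ pre))
                   (trans (cong (_+ 1) (m+n∸n≡m (length pre) (suc (length post)))) (+-comm (length pre) 1))

-- The stack machine

-- Stacks are lists with the top first.  pop x st pops until x can be pushed and returns the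
-- popped entries with the remaining stack; feed returns the output so far with the final stack.
pop : ℕ → List ℕ → List ℕ × List ℕ
pop x []       = [] , []
pop x (y ∷ ys) = if avoids123-132 (x ∷ y ∷ ys) then ([] , y ∷ ys) else map₁ (y ∷_) (pop x ys)

feed : List ℕ → List ℕ → List ℕ × List ℕ
feed []       st = [] , st
feed (x ∷ xs) st = map₁ (proj₁ (pop x st) ++_) (feed xs (x ∷ proj₂ (pop x st)))

output stack run : List ℕ → List ℕ → List ℕ
output xs st = proj₁ (feed xs st)
stack  xs st = proj₂ (feed xs st)
run    xs st = output xs st ++ stack xs st

measure-push : ∀ m k → m + 2 * suc k ≡ suc (suc (m + 2 * k))
measure-push m k = trans (cong (m +_) (*-suc 2 k)) (trans (+-suc m _) (cong suc (+-suc m _)))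

stackRun≡run : ∀ f xs st → length st + 2 * length xs < f → stackRun f xs st ≡ run xs st
stackRun≡run (suc f) []       st       _  = refl
stackRun≡run (suc f) (x ∷ xs) []       lt =
  stackRun≡run f xs (x ∷ []) (subst (_≤ f) (measure-push 0 (length xs)) (≤-pred lt))
stackRun≡run (suc f) (x ∷ xs) (y ∷ ys) lt with avoids123-132 (x ∷ y ∷ ys)
... | true  = stackRun≡run f xs (x ∷ y ∷ ys) (subst (_≤ f) (measure-push (suc (length ys)) (length xs)) (≤-pred lt))
... | false = cong (y ∷_) (stackRun≡run f (x ∷ xs) ys (≤-pred lt))

s123-132≡run : ∀ π → s123-132 π ≡ run π []
s123-132≡run π = stackRun≡run (suc (2 * length π)) π [] ≤-refl

pop-split : ∀ x st → proj₁ (pop x st) ++ proj₂ (pop x st) ≡ st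
pop-split x []       = refl
pop-split x (y ∷ ys) with avoids123-132 (x ∷ y ∷ ys)
... | true  = refl
... | false = cong (y ∷_) (pop-split x ys)

pop-avoids : ∀ x st → avoids123-132 (x ∷ proj₂ (pop x st)) ≡ true
pop-avoids x []       = refl
pop-avoids x (y ∷ ys) with avoids123-132 (x ∷ y ∷ ys) in e
... | true  = e
... | false = pop-avoids x ys

pop-stops-at : ∀ {x U} → avoids123-132 (x ∷ U) ≡ true → ∀ T → ∃[ T′ ] proj₂ (pop x (T ++ U)) ≡ T′ ++ U
pop-stops-at {x} {[]}    _  []      = [] , refl
pop-stops-at {x} {y ∷ U} av []      rewrite av = [] , refl
pop-stops-at {x} {U}     av (y ∷ T) with avoids123-132 (x ∷ y ∷ T ++ U)
... | true  = y ∷ T , refl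
... | false = pop-stops-at av T

pop-through : ∀ {x v S} T → Unique (T ++ v ∷ S) → 2 ≤ above x (v ∷ S) →
  pop x (T ++ v ∷ S) ≡ (T ++ v ∷ proj₁ (pop x S) , proj₂ (pop x S))
pop-through {x} {v} {S} []      u many rewrite push-blocked u many = refl
pop-through {x} {v} {S} (y ∷ T) u@(_ ∷ u′) many
  rewrite push-blocked u (≤-trans many (above-++ʳ x (y ∷ T) (v ∷ S)))
        | pop-through T u′ many = refl

feed-++ : ∀ xs ys st →
  feed (xs ++ ys) st ≡ (output xs st ++ output ys (stack xs st) , stack ys (stack xs st))
feed-++ []       ys st = refl
feed-++ (x ∷ xs) ys st rewrite feed-++ xs ys (x ∷ proj₂ (pop x st)) =
  cong (_, stack ys (stack xs (x ∷ proj₂ (pop x st)))) (sym (++-assoc (proj₁ (pop x st)) _ _))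

run-++ : ∀ xs ys st → run (xs ++ ys) st ≡ output xs st ++ run ys (stack xs st)
run-++ xs ys st rewrite feed-++ xs ys st = ++-assoc (output xs st) _ _

stack-∷ʳ : ∀ xs x st → stack (xs ++ x ∷ []) st ≡ x ∷ proj₂ (pop x (stack xs st))
stack-∷ʳ xs x st = cong proj₂ (feed-++ xs (x ∷ []) st)

run-↭ : ∀ xs st → run xs st ↭ xs ++ st
run-↭ []       st = ↭-refl
run-↭ (x ∷ xs) st = begin
  (o ++ output xs (x ∷ r)) ++ stack xs (x ∷ r)  ≡⟨ ++-assoc o _ _ ⟩
  o ++ run xs (x ∷ r)                           ↭⟨ ++⁺ˡ o (run-↭ xs (x ∷ r)) ⟩
  o ++ xs ++ x ∷ r                              ↭⟨ ++⁺ˡ o (shift x xs r) ⟩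
  o ++ x ∷ xs ++ r                              ↭⟨ shift x o (xs ++ r) ⟩
  x ∷ o ++ xs ++ r                              ↭⟨ prep x (shifts o xs) ⟩
  x ∷ xs ++ o ++ r                              ≡⟨ cong (λ st′ → x ∷ xs ++ st′) (pop-split x st) ⟩
  x ∷ xs ++ st                                  ∎
  where
  open PermutationReasoning
  o = proj₁ (pop x st)
  r = proj₂ (pop x st)

run-length : ∀ xs st → length (run xs st) ≡ length xs + length st
run-length xs st = trans (↭-length (run-↭ xs st)) (length-++ xs)

s123-132-↭ : ∀ xs → s123-132 xs ↭ xs
s123-132-↭ xs = ↭-trans (↭-reflexive (s123-132≡run xs)) (↭-trans (run-↭ xs []) (↭-reflexive (++-identityʳ xs)))

Unique-stack : ∀ xs → Unique xs → Unique (stack xs [])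
Unique-stack xs u =
  Unique-++⁻ʳ (output xs []) (Unique-resp-↭ (↭-sym (run-↭ xs [])) (subst Unique (sym (++-identityʳ xs)) u))

Unique-pushed : ∀ xs x → Unique (xs ++ x ∷ []) → Unique (x ∷ proj₂ (pop x (stack xs [])))
Unique-pushed xs x u = subst Unique (stack-∷ʳ xs x []) (Unique-stack (xs ++ x ∷ []) u)

feed-keeps-bottom : ∀ {U} xs → (∀ {x} → x ∈ xs → avoids123-132 (x ∷ U) ≡ true) →
  ∀ T → ∃[ T′ ] stack xs (T ++ U) ≡ T′ ++ U
feed-keeps-bottom         []       _   T = T , refl
feed-keeps-bottom {U} (x ∷ xs) can T with pop-stops-at {x} {U} (can (here refl)) T
... | T′ , eq rewrite eq = feed-keeps-bottom xs (can ∘ there) (x ∷ T′)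

run-ends-with-first : ∀ b xs → ∃[ O ] run (b ∷ xs) [] ≡ O ++ b ∷ []
run-ends-with-first b xs with feed-keeps-bottom xs (λ _ → refl) []
... | T′ , eq = output xs (b ∷ []) ++ T′ ,
  trans (cong (output xs (b ∷ []) ++_) eq) (sym (++-assoc (output xs (b ∷ [])) T′ (b ∷ [])))

first-entry-stays : ∀ b xs x → b ∈ proj₂ (pop x (stack (b ∷ xs) []))
first-entry-stays b xs x with feed-keeps-bottom {b ∷ []} xs (λ _ → refl) []
... | T , eq rewrite eq with pop-stops-at {x} {b ∷ []} refl T
...   | T′ , eq′ rewrite eq′ = ∈-++⁺ʳ T′ (here refl)

push-above : ∀ {w x S} → Unique S → avoids123-132 (w ∷ S) ≡ true → w < x → avoids123-132 (x ∷ w ∷ S) ≡ true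
push-above {w} {x} {S} u av w<x = push-avoids {x} {w ∷ S} av (begin
  above x (w ∷ S)  ≡⟨ above-reject S (<⇒≯ w<x) ⟩
  above x S        ≤⟨ above-antitone (<⇒≤ w<x) S ⟩
  above w S        ≤⟨ avoids⇒above≤1 {w} {S} u av ⟩
  1                ∎)
  where open ≤-Reasoning

stack-push-larger : ∀ {w S} → Unique S → avoids123-132 (w ∷ S) ≡ true → ∀ {xs} → All (w <_) xs →
  ∃[ T ] stack xs (w ∷ S) ≡ T ++ w ∷ S
stack-push-larger u av larger = feed-keeps-bottom _ (λ x∈ → push-above u av (All.lookup larger x∈)) []

stays-under : ∀ {v} ys w zs → Unique (ys ++ w ∷ zs) → w < v → All (λ z → ¬ z < v) zs →
  w ∈ proj₂ (pop v (stack (ys ++ w ∷ zs) []))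
stays-under {v} ys w zs u w<v none = under (subst (w ∈_) (sym pushed) (∈-++⁺ʳ Tw (here refl)))
  where
  S₁ = proj₂ (pop w (stack ys []))
  uS₁ : Unique S₁
  uS₁ with Unique-pushed ys w (Unique-++⁻ˡ (ys ++ w ∷ []) (subst Unique (sym (++-assoc ys (w ∷ []) zs)) u))
  ... | _ ∷ u′ = u′
  larger : All (w <_) (zs ++ v ∷ [])
  larger = All.++⁺ (All.map (λ z≮v → <-≤-trans w<v (≮⇒≥ z≮v)) none) (w<v ∷ [])
  kept = stack-push-larger uS₁ (pop-avoids w (stack ys [])) larger
  Tw = proj₁ kept
  pushed : v ∷ proj₂ (pop v (stack (ys ++ w ∷ zs) [])) ≡ Tw ++ w ∷ S₁
  pushed = begin
    v ∷ proj₂ (pop v (stack (ys ++ w ∷ zs) []))     ≡⟨ stack-∷ʳ (ys ++ w ∷ zs) v [] ⟨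
    stack ((ys ++ w ∷ zs) ++ v ∷ []) []             ≡⟨ cong (λ xs → stack xs []) (++-assoc ys (w ∷ zs) (v ∷ [])) ⟩
    stack (ys ++ w ∷ zs ++ v ∷ []) []               ≡⟨ cong (λ xs → stack xs []) (++-assoc ys (w ∷ []) (zs ++ v ∷ [])) ⟨
    stack ((ys ++ w ∷ []) ++ zs ++ v ∷ []) []       ≡⟨ cong proj₂ (feed-++ (ys ++ w ∷ []) (zs ++ v ∷ []) []) ⟩
    stack (zs ++ v ∷ []) (stack (ys ++ w ∷ []) [])  ≡⟨ cong (stack (zs ++ v ∷ [])) (stack-∷ʳ ys w []) ⟩
    stack (zs ++ v ∷ []) (w ∷ S₁)                   ≡⟨ proj₂ kept ⟩
    Tw ++ w ∷ S₁                                    ∎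
    where open ≡-Reasoning
  under : ∀ {S} → w ∈ v ∷ S → w ∈ S
  under (here w≡v) = contradiction w≡v (<⇒≢ w<v)
  under (there w∈) = w∈

smaller-sees-two : ∀ {u v S} → u < v → 0 < above v S → 2 ≤ above u (v ∷ S)
smaller-sees-two {u} {v} {S} u<v pos =
  subst (2 ≤_) (sym (above-accept S u<v)) (s≤s (≤-trans pos (above-antitone (<⇒≤ u<v) S)))

flush-through : ∀ {v S} T R → Unique (T ++ v ∷ S) → 0 < above v S → Maybe.All (_< v) (head R) →
  ∃[ O ] run R (T ++ v ∷ S) ≡ T ++ v ∷ O × length O ≡ length S + length R
flush-through {v} {S} T []       _  _   nothing    = S , refl , sym (+-identityʳ (length S))
flush-through {v} {S} T (u ∷ R′) uq pos (just u<v) rewrite pop-through {u} {v} {S} T uq (smaller-sees-two u<v pos) =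
  o ++ run R′ (u ∷ r) , trans (++-assoc (T ++ v ∷ o) _ _) (++-assoc T (v ∷ o) _) , lengths
  where
  o = proj₁ (pop u S)
  r = proj₂ (pop u S)
  lengths : length (o ++ run R′ (u ∷ r)) ≡ length S + suc (length R′)
  lengths = begin
    length (o ++ run R′ (u ∷ r))             ≡⟨ length-++ o ⟩
    length o + length (run R′ (u ∷ r))       ≡⟨ cong (length o +_) (run-length R′ (u ∷ r)) ⟩
    length o + (length R′ + suc (length r))  ≡⟨ solve 3 (λ a b c → a :+ (b :+ (con 1 :+ c)) := (a :+ c) :+ (con 1 :+ b))
                                                  refl (length o) (length R′) (length r) ⟩
    (length o + length r) + suc (length R′)  ≡⟨ cong (_+ suc (length R′)) (trans (sym (length-++ o)) (cong length (pop-split u S))) ⟩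
    length S + suc (length R′)               ∎
    where open ≡-Reasoning

-- One pass

-- Under v the stack holds S′, whose bottom entry is b; M is pushed onto v; the first entry
-- of R is smaller than v and so finds two larger entries, v and b, under it: it pops v and
-- all of S′.  Hence v is followed by |S′| + |R| = 1 + s + |R| entries, s being the number
-- of entries of S′ smaller than v; the last entry of L smaller than v stays in S′.
module OnePass {b v : ℕ} (L M R : List ℕ) (u : Unique (b ∷ L ++ v ∷ M ++ R)) (v<b : v < b)
               (larger : All (v <_) M) (smaller : Maybe.All (_< v) (head R)) where

  σ S′ : List ℕ
  σ  = b ∷ L
  S′ = proj₂ (pop v (stack σ []))

  input≡ : b ∷ L ++ v ∷ M ++ R ≡ (σ ++ v ∷ M) ++ R
  input≡ = cong (b ∷_) (sym (++-assoc L (v ∷ M) R))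

  σvM≡ : σ ++ v ∷ M ≡ (σ ++ v ∷ []) ++ M
  σvM≡ = cong (b ∷_) (sym (++-assoc L (v ∷ []) M))

  unique-σvM : Unique (σ ++ v ∷ M)
  unique-σvM = Unique-++⁻ˡ (σ ++ v ∷ M) (subst Unique input≡ u)

  unique-vS′ : Unique (v ∷ S′)
  unique-vS′ = Unique-pushed σ v (Unique-++⁻ˡ (σ ++ v ∷ []) (subst Unique σvM≡ unique-σvM))

  v∉S′ : v ∉ S′
  v∉S′ with unique-vS′
  ... | v∉ ∷ _ = λ v∈ → All.lookup v∉ v∈ refl

  unique-S′ : Unique S′
  unique-S′ with unique-vS′
  ... | _ ∷ u′ = u′

  avoids-vS′ : avoids123-132 (v ∷ S′) ≡ true
  avoids-vS′ = pop-avoids v (stack σ [])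

  above-S′ : above v S′ ≡ 1
  above-S′ = ≤-antisym (avoids⇒above≤1 {v} {S′} unique-S′ avoids-vS′) (above-∈ (first-entry-stays b L v) v<b)

  length-S′ : length S′ ≡ suc (below v S′)
  length-S′ = trans (length≡below+above S′ v∉S′) (trans (cong (below v S′ +_) above-S′) (+-comm (below v S′) 1))

  pushed-M : ∃[ ys ] stack M (v ∷ S′) ≡ ys ++ v ∷ S′
  pushed-M = stack-push-larger unique-S′ avoids-vS′ larger

  pile : List ℕ
  pile = proj₁ pushed-M

  stack-σvM : stack (σ ++ v ∷ M) [] ≡ pile ++ v ∷ S′
  stack-σvM = begin
    stack (σ ++ v ∷ M) []             ≡⟨ cong (λ xs → stack xs []) σvM≡ ⟩
    stack ((σ ++ v ∷ []) ++ M) []     ≡⟨ cong proj₂ (feed-++ (σ ++ v ∷ []) M []) ⟩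
    stack M (stack (σ ++ v ∷ []) [])  ≡⟨ cong (stack M) (stack-∷ʳ σ v []) ⟩
    stack M (v ∷ S′)                  ≡⟨ proj₂ pushed-M ⟩
    pile ++ v ∷ S′                       ∎
    where open ≡-Reasoning

  flushed : ∃[ O ] run R (pile ++ v ∷ S′) ≡ pile ++ v ∷ O × length O ≡ length S′ + length R
  flushed = flush-through pile R (subst Unique stack-σvM (Unique-stack (σ ++ v ∷ M) unique-σvM))
              (subst (0 <_) (sym above-S′) (s≤s z≤n)) smaller

  O₁ O₂ : List ℕ
  O₁ = output (σ ++ v ∷ M) [] ++ pile
  O₂ = proj₁ flushed

  runs : run (b ∷ L ++ v ∷ M ++ R) [] ≡ O₁ ++ v ∷ O₂
  runs = begin
    run (b ∷ L ++ v ∷ M ++ R) []          ≡⟨ cong (λ xs → run xs []) input≡ ⟩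
    run ((σ ++ v ∷ M) ++ R) []            ≡⟨ run-++ (σ ++ v ∷ M) R [] ⟩
    out ++ run R (stack (σ ++ v ∷ M) [])  ≡⟨ cong (λ st → out ++ run R st) stack-σvM ⟩
    out ++ run R (pile ++ v ∷ S′)         ≡⟨ cong (out ++_) (proj₁ (proj₂ flushed)) ⟩
    out ++ pile ++ v ∷ O₂                 ≡⟨ ++-assoc out pile (v ∷ O₂) ⟨
    O₁ ++ v ∷ O₂                          ∎
    where
    open ≡-Reasoning
    out = output (σ ++ v ∷ M) []

  length-O₂ : length O₂ ≡ suc (below v S′ + length R)
  length-O₂ = trans (proj₂ (proj₂ flushed)) (cong (_+ length R) length-S′)

  below-O₁ : below v O₁ + below v S′ ≡ below v L
  below-O₁ = begin
    below v O₁ + below v S′                ≡⟨ cong (below v O₁ +_) (below-reject S′ (<-irrefl refl)) ⟨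
    below v O₁ + below v (v ∷ S′)          ≡⟨ below-++ v O₁ (v ∷ S′) ⟨
    below v (O₁ ++ v ∷ S′)                 ≡⟨ cong (below v) (++-assoc out pile (v ∷ S′)) ⟩
    below v (out ++ pile ++ v ∷ S′)        ≡⟨ cong (λ st → below v (out ++ st)) stack-σvM ⟨
    below v (run (σ ++ v ∷ M) [])          ≡⟨ below-↭ v (run-↭ (σ ++ v ∷ M) []) ⟩
    below v ((σ ++ v ∷ M) ++ [])           ≡⟨ cong (below v) (++-identityʳ (σ ++ v ∷ M)) ⟩
    below v (b ∷ L ++ v ∷ M)               ≡⟨ below-reject (L ++ v ∷ M) (<⇒≯ v<b) ⟩
    below v (L ++ v ∷ M)                   ≡⟨ below-++ v L (v ∷ M) ⟩
    below v L + below v (v ∷ M)            ≡⟨ cong (below v L +_) (below-reject M (<-irrefl refl)) ⟩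
    below v L + below v M                  ≡⟨ cong (below v L +_) (below-none (All.map <⇒≯ larger)) ⟩
    below v L + 0                          ≡⟨ +-identityʳ (below v L) ⟩
    below v L                              ∎
    where
    open ≡-Reasoning
    out = output (σ ++ v ∷ M) []

  below-S′ : 0 < below v L → 0 < below v S′
  below-S′ some with last-below L some
  ... | L₁ , w , L₂ , refl , w<v , none = below-∈ (stays-under (b ∷ L₁) w L₂ (Unique-++⁻ˡ σ unique-σvM) w<v none) w<v

  output≡ : s123-132 (b ∷ L ++ v ∷ M ++ R) ≡ O₁ ++ v ∷ O₂
  output≡ = trans (s123-132≡run (b ∷ L ++ v ∷ M ++ R)) runs

  split-output : before v (s123-132 (b ∷ L ++ v ∷ M ++ R)) ≡ O₁ × after v (s123-132 (b ∷ L ++ v ∷ M ++ R)) ≡ O₂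
  split-output rewrite output≡ =
    split-unique O₁ O₂ (subst Unique output≡ (Unique-resp-↭ (↭-sym (s123-132-↭ (b ∷ L ++ v ∷ M ++ R))) u))

pass : ∀ {b v} L M R → Unique (b ∷ L ++ v ∷ M ++ R) → v < b → All (v <_) M → Maybe.All (_< v) (head R) →
  let π′ = s123-132 (b ∷ L ++ v ∷ M ++ R) in
  ∃[ s ] length (after v π′) ≡ suc (s + length R) × below v (before v π′) + s ≡ below v L × (0 < below v L → 0 < s)
pass {b} {v} L M R u v<b larger smaller =
  below v S′ , trans (cong length (proj₂ split-output)) length-O₂ ,
  trans (cong (λ xs → below v xs + below v S′) (proj₁ split-output)) below-O₁ , below-S′
  where open OnePass L M R u v<b larger smaller

-- Iterating the map

iter-suc : ∀ (f : List ℕ → List ℕ) k x → iter (suc k) f x ≡ f (iter k f x)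
iter-suc f zero    x = refl
iter-suc f (suc k) x = iter-suc f k (f x)

Unique-oneTo : ∀ n → Unique (oneTo n)
Unique-oneTo n = Unique.map⁺ suc-injective (Unique.upTo⁺ n)

∈-oneTo⁺ : ∀ {n v} → 1 ≤ v → v ≤ n → v ∈ oneTo n
∈-oneTo⁺ {v = suc k} _ k<n = ∈-map⁺ suc (∈-upTo⁺ k<n)

∈-oneTo⁻ : ∀ {n x} → x ∈ oneTo n → 1 ≤ x
∈-oneTo⁻ x∈ with ∈-map⁻ suc x∈
... | _ , _ , refl = s≤s z≤n

length-oneTo : ∀ n → length (oneTo n) ≡ n
length-oneTo n = trans (length-map suc (upTo n)) (length-upTo n)

oneTo-suc : ∀ n → oneTo (suc n) ≡ oneTo n ++ suc n ∷ []
oneTo-suc n = trans (cong (map suc) (sym (upTo-∷ʳ n))) (map-++ suc (upTo n) (n ∷ []))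

below-oneTo : ∀ n v → below v (oneTo n) ≤ v ∸ 1
below-oneTo zero    v = z≤n
below-oneTo (suc n) v with suc n <? v
... | yes 1+n<v = begin
  below v (oneTo (suc n))                  ≡⟨ cong (below v) (oneTo-suc n) ⟩
  below v (oneTo n ++ suc n ∷ [])          ≡⟨ below-++ v (oneTo n) (suc n ∷ []) ⟩
  below v (oneTo n) + below v (suc n ∷ []) ≡⟨ cong (below v (oneTo n) +_) (below-accept [] 1+n<v) ⟩
  below v (oneTo n) + 1                    ≤⟨ +-monoˡ-≤ 1 (length-filter (_<? v) (oneTo n)) ⟩
  length (oneTo n) + 1                     ≡⟨ cong (_+ 1) (length-oneTo n) ⟩
  n + 1                                    ≡⟨ +-comm n 1 ⟩
  suc (suc n) ∸ 1                          ≤⟨ ∸-monoˡ-≤ 1 1+n<v ⟩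
  v ∸ 1                                    ∎
  where open ≤-Reasoning
... | no 1+n≮v = begin
  below v (oneTo (suc n))                  ≡⟨ cong (below v) (oneTo-suc n) ⟩
  below v (oneTo n ++ suc n ∷ [])          ≡⟨ below-++ v (oneTo n) (suc n ∷ []) ⟩
  below v (oneTo n) + below v (suc n ∷ []) ≡⟨ cong (below v (oneTo n) +_) (below-reject [] 1+n≮v) ⟩
  below v (oneTo n) + 0                    ≡⟨ +-identityʳ _ ⟩
  below v (oneTo n)                        ≤⟨ below-oneTo n v ⟩
  v ∸ 1                                    ∎
  where open ≤-Reasoning

+-suc-≤ : ∀ v k t → v + suc k ≤ suc t → v + k ≤ t
+-suc-≤ v k t le = ≤-pred (subst (_≤ suc t) (+-suc v k) le)

∸1-bound : ∀ {m s k} → m + s ≡ k → (0 < k → 0 < s) → m ≤ k ∸ 1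
∸1-bound {m} {s} {zero}  eq  _   = ≤-reflexive (m+n≡0⇒m≡0 m eq)
∸1-bound {m} {s} {suc k} eq pos = ≤-pred (begin
  suc m   ≡⟨ +-comm 1 m ⟩
  m + 1   ≤⟨ +-monoʳ-≤ m (pos (s≤s z≤n)) ⟩
  m + s   ≡⟨ eq ⟩
  suc k   ∎)
  where open ≤-Reasoning

module Iterates (n : ℕ) (π : List ℕ) (π↭ : π ↭ oneTo n) where

  P : ℕ → List ℕ
  P t = iter t s123-132 π

  P-suc : ∀ t → P (suc t) ≡ s123-132 (P t)
  P-suc t = iter-suc s123-132 t π

  P-↭ : ∀ t → P t ↭ oneTo n
  P-↭ zero    = π↭
  P-↭ (suc t) = ↭-trans (↭-reflexive (P-suc t)) (↭-trans (s123-132-↭ (P t)) (P-↭ t))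

  P-unique : ∀ t → Unique (P t)
  P-unique t = Unique-resp-↭ (↭-sym (P-↭ t)) (Unique-oneTo n)

  ∈-P : ∀ t {v} → 1 ≤ v → v ≤ n → v ∈ P t
  ∈-P t 1≤v v≤n = ∈-resp-↭ (↭-sym (P-↭ t)) (∈-oneTo⁺ 1≤v v≤n)

  P-positive : ∀ t {x} → x ∈ P t → 1 ≤ x
  P-positive t x∈ = ∈-oneTo⁻ (∈-resp-↭ (P-↭ t) x∈)

  P-length : ∀ t → length (P t) ≡ n
  P-length t = trans (↭-length (P-↭ t)) (length-oneTo n)

  P-split : ∀ t {v} pre post → P t ≡ pre ++ v ∷ post → before v (P t) ≡ pre × after v (P t) ≡ post
  P-split t pre post eq rewrite eq = split-unique pre post (subst Unique eq (P-unique t))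

  P-∷ : 1 ≤ n → ∀ t → ∃[ b ] ∃[ X ] P t ≡ b ∷ X
  P-∷ 1≤n t with P t in eq
  ... | []    = contradiction (trans (sym (P-length t)) (cong length eq)) (λ n≡0 → <⇒≢ 1≤n (sym n≡0))
  ... | b ∷ X = b , X , refl

  pass-around : ∀ {t b X v} → P t ≡ b ∷ X → v < b → 1 ≤ v → v ≤ n →
    ∃[ L ] ∃[ M ] ∃[ R ] ∃[ s ] P t ≡ b ∷ L ++ v ∷ M ++ R × All (v <_) M × Maybe.All (_< v) (head R)
      × length (after v (P (suc t))) ≡ suc (s + length R)
      × below v (before v (P (suc t))) + s ≡ below v L × (0 < below v L → 0 < s)
  pass-around {t} {b} {X} {v} eq v<b 1≤v v≤n with subst Unique eq (P-unique t)
  ... | u@(_ ∷ uX) with decompose X uX v∈X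
    where
    v∈X : v ∈ X
    v∈X with subst (v ∈_) eq (∈-P t 1≤v v≤n)
    ... | here v≡b = contradiction v≡b (<⇒≢ v<b)
    ... | there v∈ = v∈
  ...   | L , M , R , refl , larger , smaller with pass L M R u v<b larger smaller
  ...     | s , len , cnt , pos rewrite P-suc t | eq = L , M , R , s , refl , larger , smaller , len , cnt , pos

  ShortTail : ℕ → ℕ → Set
  ShortTail v t = suc (length (after v (P t))) ≤ 2 * v

  head-short-tail : ∀ {t b X} → P t ≡ b ∷ X → ShortTail b t → n ≤ 2 * b
  head-short-tail {t} {b} {X} eq short = subst (_≤ 2 * b) length≡n short
    where
    length≡n : suc (length (after b (P t))) ≡ n
    length≡n = begin
      suc (length (after b (P t)))  ≡⟨ cong (suc ∘ length) (proj₂ (P-split t [] X eq)) ⟩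
      length (b ∷ X)                ≡⟨ cong length eq ⟨
      length (P t)                  ≡⟨ P-length t ⟩
      n                             ∎
      where open ≡-Reasoning

  TailBound : ℕ → ℕ → Set
  TailBound v t = length (after v (P (suc t))) ≤ 1
            ⊎ ∃[ u ] u < v × u ∈ P t × length (after v (P (suc t))) ≤ 2 + length (after u (P t))

  tail-bound-none-below : ∀ {t v} b L M R → P t ≡ b ∷ L ++ v ∷ M ++ R → Maybe.All (_< v) (head R) →
    length (after v (P (suc t))) ≡ suc (length R) → TailBound v t
  tail-bound-none-below b L M []       Pt≡ nothing      len = inj₁ (≤-reflexive len)
  tail-bound-none-below {t} {v} b L M (u ∷ R) Pt≡ (just u<v) len =
    inj₂ (u , u<v , subst (u ∈_) (sym Pt≡′) (∈-++⁺ʳ (b ∷ L ++ v ∷ M) (here refl)) , ≤-reflexive (trans len after-u))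
    where
    Pt≡′ : P t ≡ (b ∷ L ++ v ∷ M) ++ u ∷ R
    Pt≡′ = trans Pt≡ (cong (b ∷_) (sym (++-assoc L (v ∷ M) (u ∷ R))))
    after-u : suc (length (u ∷ R)) ≡ 2 + length (after u (P t))
    after-u = cong (λ A → 2 + length A) (sym (proj₂ (P-split t (b ∷ L ++ v ∷ M) R Pt≡′)))

  tail-bound-first-below : ∀ {t v s} b L M R → P t ≡ b ∷ L ++ v ∷ M ++ R → 0 < below v L → s ≤ below v L →
    length (after v (P (suc t))) ≡ suc (s + length R) → TailBound v t
  tail-bound-first-below {t} {v} {s} b L M R Pt≡ some s≤ len with first-below L some
  ... | L₁ , w , L₂ , refl , w<v , none₁ =
    inj₂ (w , w<v , subst (w ∈_) (sym Pt≡′) (∈-++⁺ʳ (b ∷ L₁) (here refl)) , bound)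
    where
    Pt≡′ : P t ≡ (b ∷ L₁) ++ w ∷ L₂ ++ v ∷ M ++ R
    Pt≡′ = trans Pt≡ (cong (b ∷_) (++-assoc L₁ (w ∷ L₂) (v ∷ M ++ R)))
    s≤′ : s ≤ suc (length L₂)
    s≤′ = begin
      s                                    ≤⟨ s≤ ⟩
      below v (L₁ ++ w ∷ L₂)               ≡⟨ below-++ v L₁ (w ∷ L₂) ⟩
      below v L₁ + below v (w ∷ L₂)        ≡⟨ cong (_+ below v (w ∷ L₂)) (below-none none₁) ⟩
      below v (w ∷ L₂)                     ≤⟨ length-filter (_<? v) (w ∷ L₂) ⟩
      suc (length L₂)                      ∎
      where open ≤-Reasoning
    bound : length (after v (P (suc t))) ≤ 2 + length (after w (P t))
    bound = begin
      length (after v (P (suc t)))                   ≡⟨ len ⟩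
      suc (s + length R)                             ≤⟨ s≤s (+-monoˡ-≤ (length R) s≤′) ⟩
      2 + (length L₂ + length R)                     ≤⟨ +-monoʳ-≤ 2 (+-monoʳ-≤ (length L₂) (m≤n+m (length R) (suc (length M)))) ⟩
      2 + (length L₂ + (suc (length M) + length R))  ≡⟨ cong (λ k → 2 + (length L₂ + suc k)) (length-++ M) ⟨
      2 + (length L₂ + length (v ∷ M ++ R))          ≡⟨ cong (2 +_) (length-++ L₂) ⟨
      2 + length (L₂ ++ v ∷ M ++ R)                  ≡⟨ cong (λ A → 2 + length A) (proj₂ (P-split t (b ∷ L₁) (L₂ ++ v ∷ M ++ R) Pt≡′)) ⟨
      2 + length (after w (P t))                     ∎
      where open ≤-Reasoning

  tail-bound : ∀ {t b X v} → P t ≡ b ∷ X → v < b → 1 ≤ v → v ≤ n → TailBound v t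
  tail-bound {t} {b} {X} {v} eq v<b 1≤v v≤n with pass-around {t} eq v<b 1≤v v≤n
  ... | L , M , R , s , Pt≡ , _ , smaller , len , cnt , _ with 0 <? below v L
  ...   | yes some = tail-bound-first-below {t} b L M R Pt≡ some (subst (s ≤_) cnt (m≤n+m s (below v (before v (P (suc t)))))) len
  ...   | no ¬some =
    tail-bound-none-below {t} b L M R Pt≡ smaller (subst (λ k → length (after v (P (suc t))) ≡ suc (k + length R)) s≡0 len)
    where
    s≡0 : s ≡ 0
    s≡0 = m+n≡0⇒n≡0 (below v (before v (P (suc t)))) (trans cnt (n≤0⇒n≡0 (≮⇒≥ ¬some)))

  n-positive : ∀ {v} → 1 ≤ v → 2 * v < n → 1 ≤ n
  n-positive {v} 1≤v 2v<n = ≤-trans 1≤v (≤-trans (m≤m+n v (v + 0)) (<⇒≤ 2v<n))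

  half-bound : ∀ {v} → 2 * v < n → v ≤ n
  half-bound {v} 2v<n = ≤-trans (m≤m+n v (v + 0)) (<⇒≤ 2v<n)

  short-tail : ∀ v → 1 ≤ v → 2 * v < n → ∀ t → v ≤ t → ShortTail v t
  short-tail = <-rec (λ v → 1 ≤ v → 2 * v < n → ∀ t → v ≤ t → ShortTail v t) step
    where
    step : ∀ v → (∀ {u} → u < v → 1 ≤ u → 2 * u < n → ∀ t → u ≤ t → ShortTail u t) →
           1 ≤ v → 2 * v < n → ∀ t → v ≤ t → ShortTail v t
    step v IH 1≤v 2v<n zero    v≤0   = contradiction (≤-trans 1≤v v≤0) λ ()
    step v IH 1≤v 2v<n (suc t) v≤1+t with P-∷ (n-positive 1≤v 2v<n) t
    ... | b , X , eq with <-cmp b v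
    ...   | tri< b<v _ _ = contradiction (head-short-tail {t} eq (IH b<v 1≤b 2b<n t (≤-pred (≤-trans b<v v≤1+t)))) (<⇒≱ 2b<n)
      where
      1≤b = P-positive t (subst (b ∈_) (sym eq) (here refl))
      2b<n = <-trans (*-monoʳ-< 2 b<v) 2v<n
    ...   | tri≈ _ refl _ =
      subst (λ A → suc (length A) ≤ 2 * b) (sym (proj₂ (P-split (suc t) O [] last))) (≤-trans 1≤v (m≤m+n v (v + 0)))
      where
      O = proj₁ (run-ends-with-first b X)
      last : P (suc t) ≡ O ++ b ∷ []
      last = trans (P-suc t) (trans (cong s123-132 eq) (trans (s123-132≡run (b ∷ X)) (proj₂ (run-ends-with-first b X))))
    ...   | tri> _ _ v<b with tail-bound {t} eq v<b 1≤v (half-bound 2v<n)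
    ...     | inj₁ ≤1 = ≤-trans (s≤s ≤1) (*-monoʳ-≤ 2 1≤v)
    ...     | inj₂ (u , u<v , u∈ , ≤2+) = begin
      suc (length (after v (P (suc t))))  ≤⟨ s≤s ≤2+ ⟩
      2 + suc (length (after u (P t)))     ≤⟨ +-monoʳ-≤ 2 (IH u<v (P-positive t u∈) 2u<n t (≤-pred (≤-trans u<v v≤1+t))) ⟩
      2 + 2 * u                            ≡⟨ *-suc 2 u ⟨
      2 * suc u                            ≤⟨ *-monoʳ-≤ 2 u<v ⟩
      2 * v                                ∎
      where
      open ≤-Reasoning
      2u<n = <-trans (*-monoʳ-< 2 u<v) 2v<n

  head-above : ∀ {v t b X} → 1 ≤ v → 2 * v < n → v ≤ t → P t ≡ b ∷ X → v < b
  head-above {v} {t} {b} 1≤v 2v<n v≤t eq = ≰⇒> λ b≤v →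
    let 2b<n = ≤-<-trans (*-monoʳ-≤ 2 b≤v) 2v<n
        1≤b  = P-positive t (subst (b ∈_) (sym eq) (here refl))
    in <⇒≱ 2b<n (head-short-tail {t} eq (short-tail b 1≤b 2b<n t (≤-trans b≤v v≤t)))

  below-P : ∀ t v → below v (P t) ≤ v ∸ 1
  below-P t v = subst (_≤ v ∸ 1) (sym (below-↭ v (P-↭ t))) (below-oneTo n v)

  few-below-before : ∀ v → 1 ≤ v → 2 * v < n → ∀ k t → v + k ≤ t → below v (before v (P t)) ≤ v ∸ 1 ∸ k
  few-below-before v 1≤v 2v<n zero    t       _  =
    ≤-trans (below-before (P t) (∈-P t 1≤v (half-bound 2v<n))) (below-P t v)
  few-below-before v 1≤v 2v<n (suc k) zero    le = contradiction (≤-trans (m≤n+m (suc k) v) le) λ ()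
  few-below-before v 1≤v 2v<n (suc k) (suc t) le with P-∷ (n-positive 1≤v 2v<n) t
  ... | b , X , eq with head-above 1≤v 2v<n (≤-trans (m≤m+n v k) (+-suc-≤ v k t le)) eq
  ...   | v<b with pass-around {t} eq v<b 1≤v (half-bound 2v<n)
  ...     | L , M , R , s , Pt≡ , _ , _ , _ , cnt , pos = begin
    below v (before v (P (suc t)))  ≤⟨ ∸1-bound cnt pos ⟩
    below v L ∸ 1                   ≡⟨ cong (_∸ 1) before-below ⟩
    below v (before v (P t)) ∸ 1    ≤⟨ ∸-monoˡ-≤ 1 (few-below-before v 1≤v 2v<n k t (+-suc-≤ v k t le)) ⟩
    v ∸ 1 ∸ k ∸ 1                   ≡⟨ ∸-+-assoc (v ∸ 1) k 1 ⟩
    v ∸ 1 ∸ (k + 1)                 ≡⟨ cong (v ∸ 1 ∸_) (+-comm k 1) ⟩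
    v ∸ 1 ∸ suc k                   ∎
    where
    open ≤-Reasoning
    before-below : below v L ≡ below v (before v (P t))
    before-below = trans (sym (below-reject L (<⇒≯ v<b))) (cong (below v) (sym (proj₁ (P-split t (b ∷ L) (M ++ R) Pt≡))))

  double-≤ : ∀ v′ t → 2 * suc v′ ≤ suc t → suc v′ + v′ ≤ t
  double-≤ v′ t le = ≤-pred (subst (_≤ suc t) 2v≡ le)
    where
    2v≡ : 2 * suc v′ ≡ suc (suc v′ + v′)
    2v≡ = trans (cong (suc v′ +_) (+-identityʳ (suc v′))) (+-suc (suc v′) v′)

  settled-pass : ∀ {v} → 1 ≤ v → 2 * v < n → ∀ t → 2 * v ≤ suc t →
    ∃[ pre ] ∃[ R ] P t ≡ pre ++ R × Maybe.All (_< v) (head R) × (∀ {x} → 1 ≤ x → x < v → x ∈ R)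
      × suc (length (after v (P (suc t)))) ≡ suc (suc (length R))
  settled-pass {suc v′} 1≤v 2v<n t le with P-∷ (n-positive 1≤v 2v<n) t
  ... | b , X , eq with head-above 1≤v 2v<n (≤-trans (m≤m+n (suc v′) v′) (double-≤ v′ t le)) eq
  ...   | v<b with pass-around {t} eq v<b 1≤v (half-bound 2v<n)
  ...     | L , M , R , s , Pt≡ , larger , smaller , len , cnt , _ =
    b ∷ L ++ v ∷ M , R , trans Pt≡ (cong (b ∷_) (sym (++-assoc L (v ∷ M) R))) , smaller , tail ,
    cong suc (trans len (cong (λ k → suc (k + length R)) s≡0))
    where
    v = suc v′
    before≡ : before v (P t) ≡ b ∷ L
    before≡ = proj₁ (P-split t (b ∷ L) (M ++ R) Pt≡)
    none-before : below v (before v (P t)) ≡ 0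
    none-before = n≤0⇒n≡0 (subst (below v (before v (P t)) ≤_) (n∸n≡0 v′)
                                 (few-below-before v 1≤v 2v<n v′ t (double-≤ v′ t le)))
    s≡0 : s ≡ 0
    s≡0 = m+n≡0⇒n≡0 (below v (before v (P (suc t))))
            (trans cnt (trans (sym (below-reject L (<⇒≯ v<b))) (trans (cong (below v) (sym before≡)) none-before)))
    tail : ∀ {x} → 1 ≤ x → x < v → x ∈ R
    tail {x} 1≤x x<v with ∈-++⁻ M (subst (x ∈_) (proj₂ (P-split t (b ∷ L) (M ++ R) Pt≡))
                         (∈-after (P t) (∈-P t 1≤v (half-bound 2v<n)) none-before x∈ x<v))
      where x∈ = ∈-P t 1≤x (≤-trans (<⇒≤ x<v) (half-bound 2v<n))
    ... | inj₁ x∈M = contradiction (All.lookup larger x∈M) (<⇒≯ x<v)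
    ... | inj₂ x∈R = x∈R

  exact-tail : ∀ v → 1 ≤ v → 2 * v < n → ∀ t → 2 * v ≤ t → suc (length (after v (P t))) ≡ 2 * v
  exact-tail (suc v′) 1≤v 2v<n zero ()
  exact-tail 1 1≤v 2v<n (suc t) le with settled-pass 1≤v 2v<n t le
  ... | pre , []     , _   , nothing     , _ , len = len
  ... | pre , u ∷ R′ , Pt≡ , just u<1 , _ , _   =
    contradiction (P-positive t (subst (u ∈_) (sym Pt≡) (∈-++⁺ʳ pre (here refl)))) (<⇒≱ u<1)
  exact-tail (suc v′@(suc _)) 1≤v 2v<n (suc t) le with settled-pass 1≤v 2v<n t le
  ... | pre , []     , _   , _          , tail , _   = contradiction (tail (s≤s z≤n) ≤-refl) λ ()
  ... | pre , u ∷ R′ , Pt≡ , just u<v , tail , len with tail (s≤s z≤n) ≤-refl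
  ...   | here refl = begin
    suc (length (after (suc v′) (P (suc t))))  ≡⟨ len ⟩
    suc (suc (suc (length R′)))               ≡⟨ cong (λ A → suc (suc (suc (length A)))) after-u ⟨
    suc (suc (suc (length (after v′ (P t)))))  ≡⟨ cong (suc ∘ suc) (exact-tail v′ (s≤s z≤n) 2v′<n t 2v′≤t) ⟩
    suc (suc (2 * v′))                        ≡⟨ *-suc 2 v′ ⟨
    2 * suc v′                                ∎
    where
    open ≡-Reasoning
    after-u = proj₂ (P-split t pre R′ Pt≡)
    2v′<n = <-trans (*-monoʳ-< 2 (n<1+n v′)) 2v<n
    2v′≤t = ≤-pred (≤-trans (*-monoʳ-< 2 (n<1+n v′)) le)
  ...   | there v′∈R′ = contradiction (begin-strict
    2 * v′                            ≡⟨ exact-tail v′ (s≤s z≤n) 2v′<n t 2v′≤t ⟨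
    suc (length (after v′ (P t)))     <⟨ s≤s (after-shrinks (P t) (P-unique t) u∈ (subst (v′ ∈_) (sym after-u) v′∈R′)) ⟩
    suc (length (after u (P t)))      ≤⟨ short-tail u 1≤u 2u<n t (≤-trans u≤v′ (≤-trans (m≤m+n v′ (v′ + 0)) 2v′≤t)) ⟩
    2 * u                             ≤⟨ *-monoʳ-≤ 2 u≤v′ ⟩
    2 * v′                            ∎) (<-irrefl refl)
    where
    open ≤-Reasoning
    after-u = proj₂ (P-split t pre R′ Pt≡)
    u∈ = subst (u ∈_) (sym Pt≡) (∈-++⁺ʳ pre (here refl))
    1≤u = P-positive t u∈
    u≤v′ = ≤-pred u<v
    2v′<n = <-trans (*-monoʳ-< 2 (n<1+n v′)) 2v<n
    2u<n = ≤-<-trans (*-monoʳ-≤ 2 u≤v′) 2v′<n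
    2v′≤t = ≤-pred (≤-trans (*-monoʳ-< 2 (n<1+n v′)) le)

2*half≤ : ∀ a → 2 * (a / 2) ≤ a
2*half≤ a = subst (_≤ a) (*-comm (a / 2) 2) (m/n*n≤m a 2)

lemma3p10 : (n i : ℕ) (π : List ℕ) → 1 ≤ n → 1 ≤ i → i ≤ (n ∸ 1) / 2 → π ↭ oneTo n →
    (m : ℕ) → 1 ≤ m → m ≤ i →
    entry (iter (i + (n ∸ 1) / 2) s123-132 π) (n ∸ 2 * m + 1) ≡ just m
lemma3p10 n i π 1≤n _ i≤half π↭ m 1≤m m≤i = begin
  entry (P t) (n ∸ 2 * m + 1)                               ≡⟨ cong (λ k → entry (P t) (k + 1)) lengths ⟩
  entry (P t) (length (P t) ∸ suc (length A) + 1)           ≡⟨ cong (λ xs → entry xs (length xs ∸ suc (length A) + 1)) split ⟩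
  entry (B ++ m ∷ A) (length (B ++ m ∷ A) ∸ suc (length A) + 1) ≡⟨ entry-from-end B m A ⟩
  just m                                                    ∎
  where
  open Iterates n π π↭
  open ≡-Reasoning
  t = i + (n ∸ 1) / 2
  B = before m (P t)
  A = after m (P t)
  m≤half = ≤-trans m≤i i≤half
  2m<n : 2 * m < n
  2m<n = ≤-<-trans (≤-trans (*-monoʳ-≤ 2 m≤half) (2*half≤ (n ∸ 1))) (∸-monoʳ-< (s≤s z≤n) 1≤n)
  2m≤t : 2 * m ≤ t
  2m≤t = +-mono-≤ m≤i (subst (_≤ (n ∸ 1) / 2) (sym (+-identityʳ m)) m≤half)
  split : P t ≡ B ++ m ∷ A
  split = ∈⇒split (P t) (∈-P t 1≤m (half-bound 2m<n))
  lengths : n ∸ 2 * m ≡ length (P t) ∸ suc (length A)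
  lengths = cong₂ _∸_ (sym (P-length t)) (sym (exact-tail m 1≤m 2m<n t 2m≤t))
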